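{- Let $A\to X$ be a cofibration of digraphs and let $B\to Y$ be a digraph map which is a retract of $A\to X$ in the arrow category, i.e. there is a commutative diagram \[\begin{array}{ccccc} B & \xrightarrow{i} & A & \xrightarrow{f} & B\\ \downarrow && \downarrow && \downarrow\\ Y & \xrightarrow{j} & X & \xrightarrow{g} & Y\end{array}\] with $fi=\mathrm{id}_B$ and $gj=\mathrm{id}_Y$. Then $B\to Y$ is a cofibration.
   Context: A digraph $X$ is a set $X_V$ with a reflexive binary relation ($x\to y$ an edge); maps preserve the relation. Induced subgraph $A\subseteq X$: for $a,b\in A_V$, $a\to b$ in $A$ iff in $X$. Path of length $n$: $v_0\to\dots\to v_n$. $X^A$: induced subgraph on vertices admitting a path to some vertex of $A$. A projecting decomposition of $X$ w.r.t. $A$: $\pi\colon X^A_V\to A_V$ such that for any $x\in X_V$ and $a\in A_V$ admitting a path from $x$, some minimal-length path from $x$ to $a$ passes through $\pi x$. A cofibration: an induced subgraph inclusion $A\to X$ (a map injective on vertices identifying $A$ with an induced subgraph) with no edges from vertices of $A$ to vertices outside $A$, such that $X$ admits a projecting decomposition w.r.t. $A$. -}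

module Defs where

open import Level using (Level; _⊔_) renaming (suc to lsuc)
open import Data.Nat using (ℕ; zero; suc; _≤_)
open import Data.Product using (Σ; ∃; ∃-syntax; _×_; _,_)
open import Relation.Binary.PropositionalEquality using (_≡_)
open import Function.Definitions using (Injective)
open import Data.List using (List; []; _∷_)
open import Data.List.Membership.Propositional using (_∈_)

record Digraph : Set₁ where
  field
    V     : Set
    E     : V → V → Set
    E-refl : (x : V) → E x x
open Digraph public

record Hom (X Y : Digraph) : Set where
  field
    fun  : V X → V Y
    pres : {x y : V X} → E X x y → E Y (fun x) (fun y)
open Hom public

idH : (X : Digraph) → Hom X X
idH X = record { fun = λ x → x ; pres = λ e → e }

_∘H_ : {X Y Z : Digraph} → Hom Y Z → Hom X Y → Hom X Z
g ∘H f = record { fun = λ x → fun g (fun f x) ; pres = λ e → pres g (pres f e) }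

_≈H_ : {X Y : Digraph} → Hom X Y → Hom X Y → Set
_≈H_ {X} f g = (x : V X) → fun f x ≡ fun g x

data Path (X : Digraph) : V X → V X → ℕ → Set where
  [_]  : (x : V X) → Path X x x zero
  _∷_  : {x y z : V X} {n : ℕ} → E X x y → Path X y z n → Path X x z (suc n)

vertices : {X : Digraph} {x y : V X} {n : ℕ} → Path X x y n → List (V X)
vertices [ x ] = x ∷ []
vertices (_∷_ {x = x} e p) = x ∷ vertices p

PassesThrough : {X : Digraph} {x y : V X} {n : ℕ} → Path X x y n → V X → Set
PassesThrough p v = v ∈ vertices p

MinPathThrough : (X : Digraph) → V X → V X → V X → Set
MinPathThrough X x y v =
  Σ ℕ λ n → Σ (Path X x y n) λ p →
    PassesThrough p v × ((m : ℕ) → Path X x y m → n ≤ m)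

-- An induced subgraph inclusion A → X: a map injective on vertices
-- which also reflects edges (so A is identified with the induced subgraph
-- on its image).
record IsInducedInclusion {A X : Digraph} (u : Hom A X) : Set where
  field
    injective : Injective _≡_ _≡_ (fun u)
    reflects  : {a b : V A} → E X (fun u a) (fun u b) → E A a b

InXA : {A X : Digraph} → Hom A X → V X → Set
InXA {A} {X} u x = Σ (V A) λ a → Σ ℕ λ n → Path X x (fun u a) n

record ProjectingDecomposition {A X : Digraph} (u : Hom A X) : Set where
  field
    π : (x : V X) → InXA u x → V A
    minimal : (x : V X) (h : InXA u x) (a : V A) (n : ℕ) →
              Path X x (fun u a) n →
              MinPathThrough X x (fun u a) (fun u (π x h))

record IsCofibration {A X : Digraph} (u : Hom A X) : Set where
  field
    inclusion : IsInducedInclusion u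
    closed    : (a : V A) (x : V X) → E X (fun u a) x → Σ (V A) λ a' → fun u a' ≡ x
    projdec   : ProjectingDecomposition u

{-# OPTIONS --safe #-}
module Submission where

open import Defs
open import Data.Nat using (ℕ)
open import Data.Product using (Σ; _,_)
open import Function.Definitions using (Injective)
open import Relation.Binary.PropositionalEquality
  using (_≡_; refl; sym; trans; cong; subst; subst₂; module ≡-Reasoning)
open import Data.List.Relation.Unary.Any using (here; there)

-- Each defining property of a cofibration is pushed from Y into X along j,
-- used for u there, and brought back along f and g; the identities
-- f ∘ i = id and g ∘ j = id make the result land where it should.  The
-- projection for B is y ↦ f (π (j y)).

module _ {X Y : Digraph} (h : Hom X Y) where

  mapPath : {x y : V X} {n : ℕ} → Path X x y n → Path Y (fun h x) (fun h y) n
  mapPath [ x ]   = [ fun h x ]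
  mapPath (e ∷ p) = pres h e ∷ mapPath p

  mapPath-passesThrough : {x y w : V X} {n : ℕ} (p : Path X x y n) →
    PassesThrough p w → PassesThrough (mapPath p) (fun h w)
  mapPath-passesThrough [ x ]   (here refl) = here refl
  mapPath-passesThrough (e ∷ p) (here refl) = here refl
  mapPath-passesThrough (e ∷ p) (there w∈p) = there (mapPath-passesThrough p w∈p)

  minPathThrough-map : {x x' w : V X} →
    ((m : ℕ) → Path Y (fun h x) (fun h x') m → Path X x x' m) →
    MinPathThrough X x x' w → MinPathThrough Y (fun h x) (fun h x') (fun h w)
  minPathThrough-map lower (n , p , w∈p , p-min) =
    n , mapPath p , mapPath-passesThrough p w∈p , λ m q → p-min m (lower m q)

OutEdgeClosed : {A X : Digraph} → Hom A X → Set
OutEdgeClosed {A} {X} u = (a : V A) (x : V X) → E X (fun u a) x → Σ (V A) λ a' → fun u a' ≡ x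

record IsRetract {A X B Y : Digraph} (v : Hom B Y) (u : Hom A X) : Set where
  field
    i  : Hom B A
    f  : Hom A B
    j  : Hom Y X
    g  : Hom X Y
    ui : (u ∘H i) ≈H (j ∘H v)
    vf : (v ∘H f) ≈H (g ∘H u)
    fi : (f ∘H i) ≈H idH B
    gj : (g ∘H j) ≈H idH Y

module _ {A X B Y : Digraph} {u : Hom A X} {v : Hom B Y} (r : IsRetract v u) where
  open IsRetract r

  injective-retract :
    Injective _≡_ _≡_ (fun u) → Injective _≡_ _≡_ (fun v)
  injective-retract u-inj {a} {b} va≡vb = begin
    a                  ≡⟨ sym (fi a) ⟩
    fun f (fun i a)    ≡⟨ cong (fun f) (u-inj uia≡uib) ⟩
    fun f (fun i b)    ≡⟨ fi b ⟩
    b                  ∎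
    where
    open ≡-Reasoning
    uia≡uib : fun u (fun i a) ≡ fun u (fun i b)
    uia≡uib = trans (ui a) (trans (cong (fun j) va≡vb) (sym (ui b)))

  isInducedInclusion-retract :
    IsInducedInclusion u → IsInducedInclusion v
  isInducedInclusion-retract u-incl = record
    { injective = injective-retract injective
    ; reflects  = λ {a} {b} e → subst₂ (E B) (fi a) (fi b)
        (pres f (reflects (subst₂ (E X) (sym (ui a)) (sym (ui b)) (pres j e))))
    }
    where open IsInducedInclusion u-incl

  outEdgeClosed-retract : OutEdgeClosed u → OutEdgeClosed v
  outEdgeClosed-retract u-closed b y e
    with u-closed (fun i b) (fun j y) (subst (λ x → E X x (fun j y)) (sym (ui b)) (pres j e))
  ... | a' , ua'≡jy = fun f a' , trans (vf a') (trans (cong (fun g) ua'≡jy) (gj y))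

  pathTo-retract : {y : V Y} {b : V B} {n : ℕ} →
    Path Y y (fun v b) n → Path X (fun j y) (fun u (fun i b)) n
  pathTo-retract {b = b} p = subst (λ x → Path X _ x _) (sym (ui b)) (mapPath j p)

  inXA-retract : {y : V Y} → InXA v y → InXA u (fun j y)
  inXA-retract (b , n , p) = fun i b , n , pathTo-retract p

  projectingDecomposition-retract :
    ProjectingDecomposition u → ProjectingDecomposition v
  projectingDecomposition-retract u-proj = record
    { π       = πv
    ; minimal = minimalv
    }
    where
    open ProjectingDecomposition u-proj

    πv : (y : V Y) → InXA v y → V B
    πv y y∈ = fun f (π (fun j y) (inXA-retract y∈))

    -- Minimality survives g because a shorter path in Y would give, via j,
    -- a shorter path in X.
    lower : {y y' : V Y} (m : ℕ) →
      Path Y (fun g (fun j y)) (fun g (fun j y')) m → Path X (fun j y) (fun j y') m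
    lower {y} {y'} m q = mapPath j (subst₂ (λ s t → Path Y s t m) (gj y) (gj y') q)

    minimalv : (y : V Y) (y∈ : InXA v y) (b : V B) (n : ℕ) → Path Y y (fun v b) n →
      MinPathThrough Y y (fun v b) (fun v (πv y y∈))
    minimalv y y∈ b n p =
      subst₂ (λ s t → MinPathThrough Y s t (fun v (πv y y∈))) (gj y) (gj (fun v b))
        (subst (MinPathThrough Y _ _) (sym (vf _)) (minPathThrough-map g lower minX))
      where
      w : V X
      w = fun u (π (fun j y) (inXA-retract y∈))

      minX : MinPathThrough X (fun j y) (fun j (fun v b)) w
      minX = subst (λ x → MinPathThrough X (fun j y) x w) (ui b)
        (minimal (fun j y) (inXA-retract y∈) (fun i b) n (pathTo-retract p))

proposition2p15 : {A X B Y : Digraph} (u : Hom A X) (v : Hom B Y)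
    (i : Hom B A) (f : Hom A B) (j : Hom Y X) (g : Hom X Y) →
    IsCofibration u →
    (u ∘H i) ≈H (j ∘H v) →
    (v ∘H f) ≈H (g ∘H u) →
    (f ∘H i) ≈H idH B →
    (g ∘H j) ≈H idH Y →
    IsCofibration v
proposition2p15 u v i f j g u-cof ui vf fi gj = record
  { inclusion = isInducedInclusion-retract r inclusion
  ; closed    = outEdgeClosed-retract r closed
  ; projdec   = projectingDecomposition-retract r projdec
  }
  where
  open IsCofibration u-cof
  r : IsRetract v u
  r = record { i = i ; f = f ; j = j ; g = g ; ui = ui ; vf = vf ; fi = fi ; gj = gj }
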